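{- Let $E$ be a type of System $\mathcal F$ and $t$ a $\lambda$-term. If $\Gamma=x_1:A_1,\dots,x_n:A_n\vdash_{\mathcal F_0}t:E$, then $\Gamma^s\vdash_{\mathcal S}t:E^s$, where $\Gamma^s=x_1:A_1^s,\dots,x_n:A_n^s$.
   Context: Types of System $\mathcal F$ are built from type variables (and type constants) with $\rightarrow$ and $\forall$. $\mathcal F_0$ derives $\Gamma\vdash_{\mathcal F_0}t:A$ by (ax); ($\rightarrow_i$) from $\Gamma,x:B\vdash t:C$ infer $\Gamma\vdash\lambda xt:B\rightarrow C$; ($\rightarrow_e$) from $\Gamma\vdash u:B\rightarrow C$, $\Gamma\vdash v:B$ infer $\Gamma\vdash(u)v:C$; ($\forall_i$) from $\Gamma\vdash t:A$, $X$ not free in $\Gamma$, infer $\Gamma\vdash t:\forall XA$. The simple system $\mathcal S$ has only quantifier-free types and the rules (ax), ($\rightarrow_i$), ($\rightarrow_e$). For a type $A$, $A^s$ is defined by: $X^s=X$ for atomic $X$; $(B\rightarrow C)^s=B^s\rightarrow C^s$; $(\forall XB)^s=B^s$. -}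

module Defs where

open import Data.Nat using (ℕ)
open import Data.List using (List; []; _∷_; map)
open import Data.Product using (_×_; _,_)
open import Relation.Binary.PropositionalEquality using (_≡_)
open import Relation.Nullary using (¬_)

TyVar : Set
TyVar = ℕ

data Type : Set where
  var   : TyVar → Type
  const : ℕ → Type
  _⇒_   : Type → Type → Type
  all   : TyVar → Type → Type

infixr 7 _⇒_

Var : Set
Var = ℕ

data Term : Set where
  v   : Var → Term
  lam : Var → Term → Term
  app : Term → Term → Term

data FreeIn (X : TyVar) : Type → Set where
  fv    : FreeIn X (var X)
  fv⇒ˡ  : ∀ {A B} → FreeIn X A → FreeIn X (A ⇒ B)
  fv⇒ʳ  : ∀ {A B} → FreeIn X B → FreeIn X (A ⇒ B)
  fvall : ∀ {Y A} → ¬ (X ≡ Y) → FreeIn X A → FreeIn X (all Y A)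

-- Contexts: list of declarations; the head is the most recent one
-- (Γ , x : B  is  (x , B) ∷ Γ).
Context : Set
Context = List (Var × Type)

-- x : A is in Γ (most recent declaration of x).
data _∋_∶_ : Context → Var → Type → Set where
  here  : ∀ {Γ x A} → ((x , A) ∷ Γ) ∋ x ∶ A
  there : ∀ {Γ x y A B} → ¬ (x ≡ y) → Γ ∋ x ∶ A → ((y , B) ∷ Γ) ∋ x ∶ A

data FreeInCtx (X : TyVar) : Context → Set where
  hd : ∀ {Γ x A} → FreeIn X A → FreeInCtx X ((x , A) ∷ Γ)
  tl : ∀ {Γ p} → FreeInCtx X Γ → FreeInCtx X (p ∷ Γ)

data _⊢F₀_∶_ : Context → Term → Type → Set where
  ax  : ∀ {Γ x A} → Γ ∋ x ∶ A → Γ ⊢F₀ v x ∶ A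
  →i  : ∀ {Γ x B C t} → ((x , B) ∷ Γ) ⊢F₀ t ∶ C → Γ ⊢F₀ lam x t ∶ (B ⇒ C)
  →e  : ∀ {Γ u w B C} → Γ ⊢F₀ u ∶ (B ⇒ C) → Γ ⊢F₀ w ∶ B → Γ ⊢F₀ app u w ∶ C
  ∀i  : ∀ {Γ t A X} → Γ ⊢F₀ t ∶ A → ¬ FreeInCtx X Γ → Γ ⊢F₀ t ∶ all X A

data QF : Type → Set where
  qvar   : ∀ {X} → QF (var X)
  qconst : ∀ {c} → QF (const c)
  q⇒     : ∀ {A B} → QF A → QF B → QF (A ⇒ B)

data QFCtx : Context → Set where
  qnil  : QFCtx []
  qcons : ∀ {Γ x A} → QF A → QFCtx Γ → QFCtx ((x , A) ∷ Γ)

data _⊢S_∶_ : Context → Term → Type → Set where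
  ax  : ∀ {Γ x A} → Γ ∋ x ∶ A → Γ ⊢S v x ∶ A
  →i  : ∀ {Γ x B C t} → QF B → ((x , B) ∷ Γ) ⊢S t ∶ C → Γ ⊢S lam x t ∶ (B ⇒ C)
  →e  : ∀ {Γ u w B C} → Γ ⊢S u ∶ (B ⇒ C) → Γ ⊢S w ∶ B → Γ ⊢S app u w ∶ C

_ˢ : Type → Type
var X ˢ = var X
const c ˢ = const c
(A ⇒ B) ˢ = (A ˢ) ⇒ (B ˢ)
all X A ˢ = A ˢ

ctxˢ : Context → Context
ctxˢ = map (λ { (x , A) → (x , A ˢ) })

module Submission where

-- The proof is by induction on the F₀
-- derivation, translating each rule into the rule of S with the same name:
--   * (ax): a declaration x : A in Γ becomes x : Aˢ in Γˢ (lookupˢ);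
--   * (→i): the bound variable gets the erased type Bˢ, which is
--     quantifier-free (qfˢ), as rule (→i) of S requires;
--   * (→e): erasure commutes with →, so the premises translate directly;
--   * (∀i): (∀X A)ˢ = Aˢ, so the conclusion is already the erased premise
--     and the side condition on X is no longer needed.

open import Defs

qfˢ : (A : Type) → QF (A ˢ)
qfˢ (var X)   = qvar
qfˢ (const c) = qconst
qfˢ (A ⇒ B)   = q⇒ (qfˢ A) (qfˢ B)
qfˢ (all X A) = qfˢ A

lookupˢ : ∀ {Γ x A} → Γ ∋ x ∶ A → ctxˢ Γ ∋ x ∶ (A ˢ)
lookupˢ here           = here
lookupˢ (there x≢y x∈) = there x≢y (lookupˢ x∈)

eraseDerivation : ∀ {Γ t E} → Γ ⊢F₀ t ∶ E → ctxˢ Γ ⊢S t ∶ (E ˢ)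
eraseDerivation (ax x∈)           = ax (lookupˢ x∈)
eraseDerivation (→i {B = B} body) = →i (qfˢ B) (eraseDerivation body)
eraseDerivation (→e fun arg)      = →e (eraseDerivation fun) (eraseDerivation arg)
eraseDerivation (∀i premise _)    = eraseDerivation premise

lemma2p2p7 : (Γ : Context) (t : Term) (E : Type) →
    Γ ⊢F₀ t ∶ E → ctxˢ Γ ⊢S t ∶ (E ˢ)
lemma2p2p7 Γ t E derivation = eraseDerivation derivation
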